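{- Let $S$ be a principal ideal domain whose field of fractions $\mathrm{Quot}(S)$ has characteristic different from $2$. Let $R$ be a ring with $S\subseteq R\subseteq\mathrm{Quot}(S)$ such that for every integer $n\ge0$ there are only finitely many non-zero frieze patterns of height $n$ over $R$. Then $R=S$.
   Context: Let $R$ be a subset of a field. A non-zero frieze pattern of height $n\ge0$ over $R$ is a family $(c_{i,j})$, indexed by $i\in\mathbb{Z}$ and $i\le j\le n+i+3$, with $c_{i,i}=c_{i,n+i+3}=0$, $c_{i,i+1}=c_{i,n+i+2}=1$, $c_{i,j}\in R\setminus\{0\}$ for $i+2\le j\le n+i+1$, and $c_{i,j}c_{i+1,j+1}-c_{i,j+1}c_{i+1,j}=1$ for all $i\in\mathbb{Z}$ and $i+1\le j\le n+i+2$. -}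

module Defs where

open import Level using (Level; _⊔_; suc)
open import Algebra.Bundles using (CommutativeRing)
open import Data.Product using (Σ; Σ-syntax; ∃; _×_; _,_)
open import Data.Nat using (ℕ)
open import Data.Integer as Int using (ℤ; +_)
open import Data.List using (List)
open import Data.List.Relation.Unary.Any using (Any)
open import Relation.Nullary using (¬_)
open import Function using (_⇔_)

module _ {c ℓ : Level} (K : CommutativeRing c ℓ) where
  open CommutativeRing K

  IsField : Set (c ⊔ ℓ)
  IsField = (¬ (0# ≈ 1#)) × (∀ x → ¬ (x ≈ 0#) → Σ[ y ∈ Carrier ] (x * y ≈ 1#))

  CharNot2 : Set ℓ
  CharNot2 = ¬ (1# + 1# ≈ 0#)

  record IsSubring {p : Level} (S : Carrier → Set p) : Set (c ⊔ ℓ ⊔ p) where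
    field
      resp : ∀ {x y} → x ≈ y → S x → S y
      has-0 : S 0#
      has-1 : S 1#
      +-closed : ∀ {x y} → S x → S y → S (x + y)
      neg-closed : ∀ {x} → S x → S (- x)
      *-closed : ∀ {x y} → S x → S y → S (x * y)

  record IsIdealOf {p : Level} (S : Carrier → Set p) (I : Carrier → Set p) : Set (c ⊔ ℓ ⊔ p) where
    field
      ⊆S : ∀ {x} → I x → S x
      resp : ∀ {x y} → x ≈ y → I x → I y
      has-0 : I 0#
      +-closed : ∀ {x y} → I x → I y → I (x + y)
      *-closed : ∀ {s x} → S s → I x → I (s * x)

  IsPrincipal : {p : Level} (S : Carrier → Set p) (I : Carrier → Set p) → Set (c ⊔ ℓ ⊔ p)
  IsPrincipal S I = Σ[ g ∈ Carrier ] (S g × (∀ x → (I x ⇔ (Σ[ s ∈ Carrier ] (S s × (x ≈ s * g))))))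

  -- S (a subring of the field K, hence an integral domain) is a principal ideal domain
  IsPID : {p : Level} (S : Carrier → Set p) → Set (c ⊔ ℓ ⊔ suc p)
  IsPID {p} S = IsSubring S × (∀ (I : Carrier → Set p) → IsIdealOf S I → IsPrincipal S I)

  IsFractionFieldOf : {p : Level} (S : Carrier → Set p) → Set (c ⊔ ℓ ⊔ p)
  IsFractionFieldOf S =
    IsField × IsSubring S ×
    (∀ x → Σ[ a ∈ Carrier ] Σ[ b ∈ Carrier ] (S a × S b × ¬ (b ≈ 0#) × (x * b ≈ a)))

  -- non-zero frieze pattern of height n over R ⊆ K.
  -- e i j is the entry c_{i,j}; only entries with i ≤ j ≤ n+i+3 are part of the pattern.
  record IsFrieze {p : Level} (R : Carrier → Set p) (n : ℕ) (e : ℤ → ℤ → Carrier) : Set (c ⊔ ℓ ⊔ p) where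
    field
      diag-0   : ∀ i → e i i ≈ 0#
      edge-0   : ∀ i → e i (+ n Int.+ i Int.+ + 3) ≈ 0#
      diag-1   : ∀ i → e i (i Int.+ + 1) ≈ 1#
      edge-1   : ∀ i → e i (+ n Int.+ i Int.+ + 2) ≈ 1#
      inner-R  : ∀ i j → i Int.+ + 2 Int.≤ j → j Int.≤ + n Int.+ i Int.+ + 1 → R (e i j)
      inner-≠0 : ∀ i j → i Int.+ + 2 Int.≤ j → j Int.≤ + n Int.+ i Int.+ + 1 → ¬ (e i j ≈ 0#)
      diamond  : ∀ i j → i Int.+ + 1 Int.≤ j → j Int.≤ + n Int.+ i Int.+ + 2 →
                 (e i j * e (i Int.+ + 1) (j Int.+ + 1)) - (e i (j Int.+ + 1) * e (i Int.+ + 1) j) ≈ 1#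

  Frieze : {p : Level} (R : Carrier → Set p) (n : ℕ) → Set (c ⊔ ℓ ⊔ p)
  Frieze R n = Σ[ e ∈ (ℤ → ℤ → Carrier) ] IsFrieze R n e

  _≋[_]_ : {p : Level} {R : Carrier → Set p} {n : ℕ} → Frieze R n → ℕ → Frieze R n → Set (ℓ)
  (e , _) ≋[ n ] (d , _) = ∀ i j → i Int.≤ j → j Int.≤ + n Int.+ i Int.+ + 3 → e i j ≈ d i j

  FinitelyManyFriezes : {p : Level} (R : Carrier → Set p) (n : ℕ) → Set (c ⊔ ℓ ⊔ p)
  FinitelyManyFriezes R n =
    Σ[ L ∈ List (Frieze R n) ] (∀ (f : Frieze R n) → Any (λ g → f ≋[ n ] g) L)

{-# OPTIONS --safe #-}
-- Write x ∈ R as a/b over the PID S and let d generate the ideal {y ∈ S | y/b ∈ R}. Then s = b/d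
-- lies in S, is invertible in R, and x s = a/d lies in S; so it suffices that every s ∈ S invertible
-- in R is already invertible in S. Since 2 ≠ 0, for a unit v = s⁻¹ ∈ R the alternating quiddities
-- (v^k, 2 s^k) define height-one friezes over R for every k; finiteness forces two of them to agree,
-- i.e. v^(m+1) = 1, whence s^m is an inverse of s in S.
module Submission where

open import Defs
open import Level using (Level)
open import Algebra.Bundles using (CommutativeRing)
open import Data.Nat as ℕ using (ℕ; zero; suc; s≤s; z≤n; parity)
import Data.Nat.Properties as ℕ
open import Data.Parity.Base using (Parity; 0ℙ; 1ℙ; _⁻¹)
open import Data.Parity.Properties using (suc-homo-⁻¹; ⁻¹-selfInverse)
open import Data.Integer as ℤ using (ℤ; +_; -[1+_]; +≤+; ∣_∣)
import Data.Integer.Properties as ℤ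
open import Data.Integer.Tactic.RingSolver using (solve-∀)
open import Data.Product using (Σ-syntax; ∃₂; _×_; _,_; proj₁; proj₂)
open import Data.Fin using (Fin; toℕ)
import Data.Fin.Properties as Fin
open import Data.List using (length; lookup)
import Data.List.Relation.Unary.Any as Any
open import Data.List.Relation.Unary.Any.Properties using (lookup-index)
open import Relation.Nullary using (¬_)
open import Relation.Binary.PropositionalEquality as ≡ using (_≡_)
open import Function using (Equivalence)
import Algebra.Properties.CommutativeSemiring.Exp as Exp
import Algebra.Properties.Ring as RingProperties

parityℤ : ℤ → Parity
parityℤ i = parity ∣ i ∣

parity-suc : ∀ n → parity (suc n) ≡ (parity n) ⁻¹
parity-suc n = ≡.sym (⁻¹-selfInverse (suc-homo-⁻¹ n))

parityℤ-suc : ∀ i → parityℤ (i ℤ.+ + 1) ≡ (parityℤ i) ⁻¹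
parityℤ-suc (+ n) rewrite ℕ.+-comm n 1 = parity-suc n
parityℤ-suc -[1+ zero ] = ≡.refl
parityℤ-suc -[1+ suc n ] = parity-suc n

[i+k]-i≡k : ∀ i k → (i ℤ.+ k) ℤ.- i ≡ k
[i+k]-i≡k = solve-∀

[n+i+k]-i≡n+k : ∀ n i k → (n ℤ.+ i ℤ.+ k) ℤ.- i ≡ n ℤ.+ k
[n+i+k]-i≡n+k = solve-∀

[j+1]-[i+1]≡j-i : ∀ i j → (j ℤ.+ + 1) ℤ.- (i ℤ.+ + 1) ≡ j ℤ.- i
[j+1]-[i+1]≡j-i = solve-∀

[j+1]-i≡[j-i]+1 : ∀ i j → (j ℤ.+ + 1) ℤ.- i ≡ (j ℤ.- i) ℤ.+ + 1
[j+1]-i≡[j-i]+1 = solve-∀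

j-[i+1]≡[j-i]-1 : ∀ i j → j ℤ.- (i ℤ.+ + 1) ≡ (j ℤ.- i) ℤ.- + 1
j-[i+1]≡[j-i]-1 = solve-∀

i+k≤j⇒k≤j-i : ∀ {i j} k → i ℤ.+ k ℤ.≤ j → k ℤ.≤ j ℤ.- i
i+k≤j⇒k≤j-i {i} {j} k h = ≡.subst (ℤ._≤ j ℤ.- i) ([i+k]-i≡k i k) (ℤ.+-monoˡ-≤ (ℤ.- i) h)

j≤n+i+k⇒j-i≤n+k : ∀ {i j} n k → j ℤ.≤ n ℤ.+ i ℤ.+ k → j ℤ.- i ℤ.≤ n ℤ.+ k
j≤n+i+k⇒j-i≤n+k {i} {j} n k h =
  ≡.subst (j ℤ.- i ℤ.≤_) ([n+i+k]-i≡n+k n i k) (ℤ.+-monoˡ-≤ (ℤ.- i) h)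

module _ {c ℓ : Level} (K : CommutativeRing c ℓ) where
  open CommutativeRing K
  open RingProperties ring using (-0#≈0#)
  open Exp commutativeSemiring using (_^_; ^-congˡ; ^-distrib-*; ^-homo-*)
  open import Relation.Binary.Reasoning.Setoid setoid

  1*1-z≈1 : ∀ {z} → z ≈ 0# → 1# * 1# - z ≈ 1#
  1*1-z≈1 {z} z≈0 = begin
    1# * 1# - z   ≈⟨ +-cong (*-identityʳ 1#) (-‿cong z≈0) ⟩
    1# + - 0#     ≈⟨ +-congˡ -0#≈0# ⟩
    1# + 0#       ≈⟨ +-identityʳ 1# ⟩
    1#            ∎

  z-1*1≈1 : ∀ {z} → z ≈ 1# + 1# → z - 1# * 1# ≈ 1#
  z-1*1≈1 {z} z≈2 = begin
    z - 1# * 1#        ≈⟨ +-cong z≈2 (-‿cong (*-identityʳ 1#)) ⟩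
    (1# + 1#) + - 1#   ≈⟨ +-assoc 1# 1# (- 1#) ⟩
    1# + (1# + - 1#)   ≈⟨ +-congˡ (-‿inverseʳ 1#) ⟩
    1# + 0#            ≈⟨ +-identityʳ 1# ⟩
    1#                 ∎

  -- Quiddity sequence (t, s, t, s, …): every diamond reads 1·1 − 0·x, ts − 1·1 or 1·1 − x·0.
  module HeightOne {p : Level} (R : Carrier → Set p) (char≠2 : CharNot2 K)
                   {t s : Carrier} (Rt : R t) (Rs : R s) (ts≈2 : t * s ≈ 1# + 1#) where

    quiddity : Parity → Carrier
    quiddity 0ℙ = t
    quiddity 1ℙ = s

    row : Parity → ℤ → Carrier
    row π (+ 1) = 1#
    row π (+ 2) = quiddity π
    row π (+ 3) = 1#
    row π _     = 0#

    entry : ℤ → ℤ → Carrier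
    entry i j = row (parityℤ i) (j ℤ.- i)

    quiddity-product : ∀ π → quiddity π * quiddity (π ⁻¹) ≈ 1# + 1#
    quiddity-product 0ℙ = ts≈2
    quiddity-product 1ℙ = trans (*-comm s t) ts≈2

    quiddity-≉0 : ∀ π → ¬ quiddity π ≈ 0#
    quiddity-≉0 π q≈0 = char≠2 (begin
      1# + 1#                       ≈⟨ quiddity-product π ⟨
      quiddity π * quiddity (π ⁻¹)  ≈⟨ *-congʳ q≈0 ⟩
      0# * quiddity (π ⁻¹)          ≈⟨ zeroˡ _ ⟩
      0#                            ∎)

    R-quiddity : ∀ π → R (quiddity π)
    R-quiddity 0ℙ = Rt
    R-quiddity 1ℙ = Rs

    row-diamond : ∀ π d → + 1 ℤ.≤ d → d ℤ.≤ + 3 →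
                  row π d * row (π ⁻¹) d - row π (d ℤ.+ + 1) * row (π ⁻¹) (d ℤ.- + 1) ≈ 1#
    row-diamond π (+ 1) _ _ = 1*1-z≈1 (zeroʳ _)
    row-diamond π (+ 2) _ _ = z-1*1≈1 (quiddity-product π)
    row-diamond π (+ 3) _ _ = 1*1-z≈1 (zeroˡ _)
    row-diamond π (+ suc (suc (suc (suc _)))) _ (+≤+ (s≤s (s≤s (s≤s ()))))
    row-diamond π (+ zero) (+≤+ ()) _
    row-diamond π -[1+ _ ] () _

    inner-offset : ∀ i j → i ℤ.+ + 2 ℤ.≤ j → j ℤ.≤ + 1 ℤ.+ i ℤ.+ + 1 → j ℤ.- i ≡ + 2
    inner-offset i j lo hi = ℤ.≤-antisym (j≤n+i+k⇒j-i≤n+k (+ 1) (+ 1) hi) (i+k≤j⇒k≤j-i (+ 2) lo)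

    entry-offset : ∀ i k → entry i (i ℤ.+ k) ≡ row (parityℤ i) k
    entry-offset i k = ≡.cong (row (parityℤ i)) ([i+k]-i≡k i k)

    entry-edge : ∀ i k → entry i (+ 1 ℤ.+ i ℤ.+ k) ≡ row (parityℤ i) (+ 1 ℤ.+ k)
    entry-edge i k = ≡.cong (row (parityℤ i)) ([n+i+k]-i≡n+k (+ 1) i k)

    isFrieze : IsFrieze K R 1 entry
    isFrieze = record
      { diag-0   = λ i → reflexive (≡.cong (row (parityℤ i)) (ℤ.+-inverseʳ i))
      ; edge-0   = λ i → reflexive (entry-edge i (+ 3))
      ; diag-1   = λ i → reflexive (entry-offset i (+ 1))
      ; edge-1   = λ i → reflexive (entry-edge i (+ 2))
      ; inner-R  = λ i j lo hi →
          ≡.subst (λ d → R (row (parityℤ i) d)) (≡.sym (inner-offset i j lo hi)) (R-quiddity (parityℤ i))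
      ; inner-≠0 = λ i j lo hi →
          ≡.subst (λ d → ¬ row (parityℤ i) d ≈ 0#) (≡.sym (inner-offset i j lo hi)) (quiddity-≉0 (parityℤ i))
      ; diamond  = diamond
      }
      where
      diamond : ∀ i j → i ℤ.+ + 1 ℤ.≤ j → j ℤ.≤ + 1 ℤ.+ i ℤ.+ + 2 →
                entry i j * entry (i ℤ.+ + 1) (j ℤ.+ + 1) - entry i (j ℤ.+ + 1) * entry (i ℤ.+ + 1) j ≈ 1#
      diamond i j lo hi
        rewrite parityℤ-suc i | [j+1]-[i+1]≡j-i i j | [j+1]-i≡[j-i]+1 i j | j-[i+1]≡[j-i]-1 i j =
        row-diamond (parityℤ i) (j ℤ.- i) (i+k≤j⇒k≤j-i (+ 1) lo) (j≤n+i+k⇒j-i≤n+k (+ 1) (+ 2) hi)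

    frieze : Frieze K R 1
    frieze = entry , isFrieze

  x*b≈a⇒a*β≈x : ∀ {x a b β} → x * b ≈ a → b * β ≈ 1# → a * β ≈ x
  x*b≈a⇒a*β≈x {x} {a} {b} {β} xb≈a bβ≈1 = begin
    a * β        ≈⟨ *-congʳ xb≈a ⟨
    (x * b) * β  ≈⟨ *-assoc x b β ⟩
    x * (b * β)  ≈⟨ *-congˡ bβ≈1 ⟩
    x * 1#       ≈⟨ *-identityʳ x ⟩
    x            ∎

  ^-closed : ∀ {p} {T : Carrier → Set p} → IsSubring K T → ∀ {x} n → T x → T (x ^ n)
  ^-closed T-subring zero    Tx = IsSubring.has-1 T-subring
  ^-closed T-subring (suc n) Tx = IsSubring.*-closed T-subring Tx (^-closed T-subring n Tx)

  1^n≈1 : ∀ n → 1# ^ n ≈ 1#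
  1^n≈1 zero    = refl
  1^n≈1 (suc n) = trans (*-identityˡ _) (1^n≈1 n)

  ^-inverse : ∀ {x y} n → x * y ≈ 1# → x ^ n * y ^ n ≈ 1#
  ^-inverse {x} {y} n xy≈1 = begin
    x ^ n * y ^ n  ≈⟨ ^-distrib-* x y n ⟨
    (x * y) ^ n    ≈⟨ ^-congˡ n xy≈1 ⟩
    1# ^ n         ≈⟨ 1^n≈1 n ⟩
    1#             ∎

  ^-periodic⇒^≈1 : ∀ {u v} i k → u * v ≈ 1# → v ^ i ≈ v ^ (i ℕ.+ k) → v ^ k ≈ 1#
  ^-periodic⇒^≈1 {u} {v} i k uv≈1 periodic = begin
    v ^ k                    ≈⟨ *-identityˡ _ ⟨
    1# * v ^ k               ≈⟨ *-congʳ (^-inverse i uv≈1) ⟨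
    (u ^ i * v ^ i) * v ^ k  ≈⟨ *-assoc _ _ _ ⟩
    u ^ i * (v ^ i * v ^ k)  ≈⟨ *-congˡ (^-homo-* v i k) ⟨
    u ^ i * v ^ (i ℕ.+ k)    ≈⟨ *-congˡ periodic ⟨
    u ^ i * v ^ i            ≈⟨ ^-inverse i uv≈1 ⟩
    1#                       ∎

  module _ {p : Level} {R : Carrier → Set p} {n : ℕ} where

    FinitelyManyFriezes⇒repetition : FinitelyManyFriezes K R n → (F : ℕ → Frieze K R n) →
                                     ∃₂ λ i m → _≋[_]_ K (F i) n (F (i ℕ.+ suc m))
    FinitelyManyFriezes⇒repetition (L , complete) F
      with i , j , i<j , same-index ← Fin.pigeonhole (ℕ.n<1+n (length L)) (λ k → Any.index (complete (F (toℕ k))))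
      with m , 1+i+m≡j ← ℕ.m≤n⇒∃[o]m+o≡n i<j
      = toℕ i , m , ≡.subst (λ k → _≋[_]_ K (F (toℕ i)) n (F k)) (≡.sym i+[1+m]≡j) F[i]≋F[j]
      where
      representative : Fin (suc (length L)) → Frieze K R n
      representative k = lookup L (Any.index (complete (F (toℕ k))))
      listed : ∀ k → _≋[_]_ K (F (toℕ k)) n (representative k)
      listed k = lookup-index (complete (F (toℕ k)))
      F[i]≋F[j] : _≋[_]_ K (F (toℕ i)) n (F (toℕ j))
      F[i]≋F[j] a b lo hi = trans
        (≡.subst (λ f → _≋[_]_ K (F (toℕ i)) n f) (≡.cong (lookup L) same-index) (listed i) a b lo hi)
        (sym (listed j a b lo hi))
      i+[1+m]≡j : toℕ i ℕ.+ suc m ≡ toℕ j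
      i+[1+m]≡j = ≡.trans (ℕ.+-suc (toℕ i) m) 1+i+m≡j

  module _ {p : Level} {S R : Carrier → Set p} (S-subring : IsSubring K S) (R-subring : IsSubring K R)
           (S⊆R : ∀ x → S x → R x) where
    open IsSubring

    R-invertible⇒S-invertible : CharNot2 K → FinitelyManyFriezes K R 1 →
                                ∀ {u v} → S u → R v → u * v ≈ 1# → Σ[ w ∈ Carrier ] (S w × u * w ≈ 1#)
    R-invertible⇒S-invertible char≠2 finite {u} {v} Su Rv uv≈1 =
      let i , m , F≋F = FinitelyManyFriezes⇒repetition finite F
          v^[1+m]≈1 = ^-periodic⇒^≈1 i (suc m) uv≈1 (F≋F (+ 0) (+ 2) (+≤+ z≤n) (+≤+ (s≤s (s≤s z≤n))))
      in u ^ m , ^-closed S-subring m Su , (begin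
           u ^ suc m                    ≈⟨ *-identityʳ _ ⟨
           u ^ suc m * 1#               ≈⟨ *-congˡ v^[1+m]≈1 ⟨
           u ^ suc m * v ^ suc m        ≈⟨ ^-inverse (suc m) uv≈1 ⟩
           1#                           ∎)
      where
      2u^k : ℕ → Carrier
      2u^k k = (1# + 1#) * u ^ k

      product≈2 : ∀ k → v ^ k * 2u^k k ≈ 1# + 1#
      product≈2 k = begin
        v ^ k * ((1# + 1#) * u ^ k)  ≈⟨ *-comm _ _ ⟩
        ((1# + 1#) * u ^ k) * v ^ k  ≈⟨ *-assoc _ _ _ ⟩
        (1# + 1#) * (u ^ k * v ^ k)  ≈⟨ *-congˡ (^-inverse k uv≈1) ⟩
        (1# + 1#) * 1#               ≈⟨ *-identityʳ _ ⟩
        1# + 1#                      ∎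

      F : ℕ → Frieze K R 1
      F k = HeightOne.frieze R char≠2 (^-closed R-subring k Rv)
              (S⊆R _ (*-closed S-subring (+-closed S-subring (has-1 S-subring) (has-1 S-subring))
                                         (^-closed S-subring k Su)))
              (product≈2 k)

    conductor : Carrier → Carrier → Set p
    conductor c y = S y × R (y * c)

    conductor-isIdeal : ∀ c → IsIdealOf K S (conductor c)
    conductor-isIdeal c = record
      { ⊆S       = proj₁
      ; resp     = λ { x≈y (Sx , Rxc) → resp S-subring x≈y Sx , resp R-subring (*-congʳ x≈y) Rxc }
      ; has-0    = has-0 S-subring , resp R-subring (sym (zeroˡ c)) (has-0 R-subring)
      ; +-closed = λ { (Sx , Rxc) (Sy , Ryc) →
          +-closed S-subring Sx Sy , resp R-subring (sym (distribʳ c _ _)) (+-closed R-subring Rxc Ryc) }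
      ; *-closed = λ { {s} {y} Ss (Sy , Ryc) →
          *-closed S-subring Ss Sy , resp R-subring (sym (*-assoc s y c)) (*-closed R-subring (S⊆R s Ss) Ryc) }
      }

    -- β = 1/b, and s = b/d, v = d/b, s′ = a/d in terms of a generator d of the conductor of β.
    R-element-denominator : IsPID K S → IsFractionFieldOf K S → ∀ {x} → R x →
                            Σ[ s ∈ Carrier ] Σ[ v ∈ Carrier ] (S s × R v × s * v ≈ 1# × S (x * s))
    R-element-denominator (_ , principal) ((_ , inverse) , _ , fraction) {x} Rx =
      let a , b , Sa , Sb , b≉0 , xb≈a = fraction x
          β , bβ≈1 = inverse b b≉0
          aβ≈x = x*b≈a⇒a*β≈x xb≈a bβ≈1
          d , _ , generates = principal (conductor β) (conductor-isIdeal β)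
          s , Ss , b≈sd = Equivalence.to (generates b) (Sb , resp R-subring (sym bβ≈1) (has-1 R-subring))
          s′ , Ss′ , a≈s′d = Equivalence.to (generates a) (Sa , resp R-subring (sym aβ≈x) Rx)
          Rdβ = proj₂ (Equivalence.from (generates d) (1# , has-1 S-subring , sym (*-identityˡ d)))
          s[dβ]≈1 = s-inverse b≈sd bβ≈1
      in s , d * β , Ss , Rdβ , s[dβ]≈1 , resp S-subring (sym (xs≈s′ aβ≈x a≈s′d s[dβ]≈1)) Ss′
      where
      s-inverse : ∀ {b s d β} → b ≈ s * d → b * β ≈ 1# → s * (d * β) ≈ 1#
      s-inverse {b} {s} {d} {β} b≈sd bβ≈1 = trans (sym (*-assoc s d β)) (trans (*-congʳ (sym b≈sd)) bβ≈1)

      xs≈s′ : ∀ {x a β s s′ d} → a * β ≈ x → a ≈ s′ * d → s * (d * β) ≈ 1# → x * s ≈ s′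
      xs≈s′ {x} {a} {β} {s} {s′} {d} aβ≈x a≈s′d s[dβ]≈1 = begin
        x * s                ≈⟨ *-congʳ aβ≈x ⟨
        (a * β) * s          ≈⟨ *-congʳ (*-congʳ a≈s′d) ⟩
        ((s′ * d) * β) * s   ≈⟨ *-congʳ (*-assoc s′ d β) ⟩
        (s′ * (d * β)) * s   ≈⟨ *-assoc s′ (d * β) s ⟩
        s′ * ((d * β) * s)   ≈⟨ *-congˡ (trans (*-comm (d * β) s) s[dβ]≈1) ⟩
        s′ * 1#              ≈⟨ *-identityʳ s′ ⟩
        s′                   ∎

proposition3p9 : {c ℓ p : Level} (K : CommutativeRing c ℓ) (S R : CommutativeRing.Carrier K → Set p)
    → IsPID K S → IsFractionFieldOf K S → CharNot2 K
    → IsSubring K R → (∀ x → S x → R x)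
    → (∀ (n : ℕ) → FinitelyManyFriezes K R n)
    → ∀ x → R x → S x
proposition3p9 K S R S-pid@(S-subring , _) S-fractions char≠2 R-subring S⊆R finite x Rx =
  let s , v , Ss , Rv , sv≈1 , Sxs = R-element-denominator K S-subring R-subring S⊆R S-pid S-fractions Rx
      w , Sw , sw≈1 = R-invertible⇒S-invertible K S-subring R-subring S⊆R char≠2 (finite 1) Ss Rv sv≈1
  in IsSubring.resp S-subring (x*b≈a⇒a*β≈x K (CommutativeRing.refl K) sw≈1) (IsSubring.*-closed S-subring Sxs Sw)
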